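{- Let $G$ be a connected cograph (with at least two vertices). Then $\chi_{td}(G)=\chi(G)$. Moreover, for every TD-coloring $\mathcal{H}$ of $G$ using $\chi_{td}(G)$ colors, the minimum number of color classes of $\mathcal{H}$ forming a family $C_0$ such that every vertex of $G$ is adjacent to all vertices of some class in $C_0$ is exactly $2$.
   Context: All graphs are finite, simple, undirected and without isolated vertices. A cograph is a graph with no induced path on four vertices. $\chi(G)$ is the chromatic number. A total dominator coloring (TD-coloring) of $G$ is a proper vertex coloring such that every vertex is adjacent to all vertices of some color class; $\chi_{td}(G)$ is the minimum number of colors in a TD-coloring. -}

module Defs where

open import Data.Nat using (ℕ; _≤_)
open import Data.Fin using (Fin)
open import Data.Fin.Subset using (Subset; _∈_; ∣_∣)
open import Data.Bool using (Bool; true; false)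
open import Data.Product using (Σ; ∃; _×_; _,_)
open import Relation.Binary.PropositionalEquality using (_≡_; _≢_)
open import Relation.Nullary using (¬_)

record Graph (n : ℕ) : Set where
  field
    adj   : Fin n → Fin n → Bool
    sym   : ∀ u v → adj u v ≡ adj v u
    irrefl : ∀ v → adj v v ≡ false
open Graph public

module _ {n : ℕ} (G : Graph n) where

  Adj : Fin n → Fin n → Set
  Adj u v = adj G u v ≡ true

  NoIsolated : Set
  NoIsolated = ∀ v → ∃ λ u → Adj v u

  data Reach : Fin n → Fin n → Set where
    here : ∀ {v} → Reach v v
    step : ∀ {u w v} → Adj u w → Reach w v → Reach u v

  Connected : Set
  Connected = ∀ u v → Reach u v

  InducedP4 : Fin n → Fin n → Fin n → Fin n → Set
  InducedP4 a b c d =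
    (a ≢ b) × (a ≢ c) × (a ≢ d) × (b ≢ c) × (b ≢ d) × (c ≢ d) ×
    Adj a b × Adj b c × Adj c d ×
    ¬ Adj a c × ¬ Adj b d × ¬ Adj a d

  Cograph : Set
  Cograph = ∀ a b c d → ¬ InducedP4 a b c d

  Proper : (k : ℕ) → (Fin n → Fin k) → Set
  Proper k c = ∀ u v → Adj u v → c u ≢ c v

  AllUsed : (k : ℕ) → (Fin n → Fin k) → Set
  AllUsed k c = ∀ (i : Fin k) → ∃ λ v → c v ≡ i

  DominatesClass : (k : ℕ) → (Fin n → Fin k) → Fin n → Fin k → Set
  DominatesClass k c v i = ∀ u → c u ≡ i → Adj v u

  IsTDColoring : (k : ℕ) → (Fin n → Fin k) → Set
  IsTDColoring k c =
    Proper k c × AllUsed k c × (∀ v → ∃ λ i → DominatesClass k c v i)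

  IsChromaticNumber : ℕ → Set
  IsChromaticNumber k =
    (∃ λ (c : Fin n → Fin k) → Proper k c) ×
    (∀ m (c : Fin n → Fin m) → Proper m c → k ≤ m)

  IsTDChromaticNumber : ℕ → Set
  IsTDChromaticNumber k =
    (∃ λ (c : Fin n → Fin k) → IsTDColoring k c) ×
    (∀ m (c : Fin n → Fin m) → IsTDColoring m c → k ≤ m)

  DominatingFamily : (k : ℕ) → (Fin n → Fin k) → Subset k → Set
  DominatingFamily k c S = ∀ v → ∃ λ i → (i ∈ S) × DominatesClass k c v i

  MinDominatingFamilySize : (k : ℕ) → (Fin n → Fin k) → ℕ → Set
  MinDominatingFamilySize k c s =
    (∃ λ (S : Subset k) → DominatingFamily k c S × ∣ S ∣ ≡ s) ×
    (∀ (S : Subset k) → DominatingFamily k c S → s ≤ ∣ S ∣)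

-- By Seinsche's theorem a cograph on at least two vertices is disconnected
-- or has a disconnected complement; a connected cograph G is therefore a
-- join of two nonempty vertex sets A and B. In a proper colouring no colour
-- meets both A and B, so every vertex of A is adjacent to the whole colour
-- class of any vertex of B, and vice versa. Hence every proper colouring is a
-- TD-colouring, χ_td(G) = χ(G), and the classes of one vertex of A and one
-- vertex of B form a dominating family. No single class can dominate,
-- because a vertex of the dominated class is not adjacent to itself.
module Submission where

open import Defs hiding (sym)
open import Data.Nat using (ℕ; zero; suc; _≤_; _<_; _+_; z≤n; s≤s)
open import Data.Nat.Properties
  using (≤-refl; ≤-trans; ≤-antisym; +-mono-≤; +-suc; n≤1+n; ≮⇒≥; 1+n≰n)
import Data.Nat.Properties as ℕ
open import Data.Nat.Induction using (<-rec)
open import Data.Fin using (Fin; zero; suc; punchOut)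
import Data.Fin as Fin
open import Data.Fin.Properties using (any?; all?; ¬∀⟶∃¬; punchOut-injective; suc-injective)
open import Data.Fin.Subset using (Subset; inside; outside; ⁅_⁆; _∪_; _⊂_; _∈_; ∣_∣)
open import Data.Fin.Subset.Properties using (x∈⁅x⁆; x∈⁅y⁆⇒x≡y; x∈p∪q⁺; ∣⁅x⁆∣≡1; p⊂q⇒∣p∣<∣q∣)
open import Data.Vec using (_∷_; [])
import Data.Vec.Functional as Vector
open import Data.Bool using (Bool; true; false; not; _∧_; if_then_else_)
import Data.Bool as Bool
open import Data.Bool.Properties using (not-injective)
open import Data.Product using (Σ; ∃; _×_; _,_; proj₁; proj₂)
open import Data.Sum using (_⊎_; inj₁; inj₂)
open import Function using (_∘_; id)
open import Relation.Nullary using (¬_; Dec; yes; no; ⌊_⌋; contradiction)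
open import Relation.Nullary.Decidable using (_×-dec_; _→-dec_; ¬?)
open import Relation.Unary using (Decidable)
open import Relation.Binary.PropositionalEquality
  using (_≡_; _≢_; refl; sym; trans; cong; cong₂; subst)

module _ {n : ℕ} (G : Graph n) where

  Adj? : ∀ u v → Dec (Adj G u v)
  Adj? u v = adj G u v Bool.≟ true

  Adj-sym : ∀ {u v} → Adj G u v → Adj G v u
  Adj-sym {u} {v} = trans (Graph.sym G v u)

  Adj⇒≢ : ∀ {u v} → Adj G u v → u ≢ v
  Adj⇒≢ {u} uu refl with trans (sym uu) (irrefl G u)
  ... | ()

complement : ∀ {n} → Graph n → Graph n
complement G = record
  { adj    = λ u v → if ⌊ u Fin.≟ v ⌋ then false else not (adj G u v)
  ; sym    = symmetric
  ; irrefl = irreflexive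
  }
  where
  symmetric : ∀ u v → (if ⌊ u Fin.≟ v ⌋ then false else not (adj G u v))
                    ≡ (if ⌊ v Fin.≟ u ⌋ then false else not (adj G v u))
  symmetric u v with u Fin.≟ v | v Fin.≟ u
  ... | yes _   | yes _   = refl
  ... | yes u≡v | no  v≢u = contradiction (sym u≡v) v≢u
  ... | no  u≢v | yes v≡u = contradiction (sym v≡u) u≢v
  ... | no  _   | no  _   = cong not (Graph.sym G u v)

  irreflexive : ∀ v → (if ⌊ v Fin.≟ v ⌋ then false else not (adj G v v)) ≡ false
  irreflexive v with v Fin.≟ v
  ... | yes _   = refl
  ... | no  v≢v = contradiction refl v≢v

module _ {n : ℕ} (G : Graph n) where

  complement-Adj⁻ : ∀ {u v} → Adj (complement G) u v → u ≢ v × ¬ Adj G u v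
  complement-Adj⁻ {u} {v} uv with u Fin.≟ v | adj G u v
  complement-Adj⁻ ()  | yes _ | _
  complement-Adj⁻ ()  | no  _ | true
  complement-Adj⁻ _   | no u≢v | false = u≢v , λ ()

  complement-Adj⁺ : ∀ {u v} → u ≢ v → ¬ Adj G u v → Adj (complement G) u v
  complement-Adj⁺ {u} {v} u≢v ¬uv with u Fin.≟ v
  ... | yes u≡v = contradiction u≡v u≢v
  ... | no  _ with adj G u v
  ...   | true  = contradiction refl ¬uv
  ...   | false = refl

  ¬complement-Adj⇒Adj : ∀ {u v} → u ≢ v → ¬ Adj (complement G) u v → Adj G u v
  ¬complement-Adj⇒Adj {u} {v} u≢v ¬uv with Adj? G u v
  ... | yes uv  = uv
  ... | no  ¬uv′ = contradiction (complement-Adj⁺ u≢v ¬uv′) ¬uv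

  complement-cograph : Cograph G → Cograph (complement G)
  complement-cograph cg a b c d
    (a≢b , a≢c , a≢d , b≢c , b≢d , c≢d , ab , bc , cd , ¬ac , ¬bd , ¬ad) =
    cg c a d b
      (a≢c ∘ sym , c≢d , b≢c ∘ sym , a≢d , a≢b , b≢d ∘ sym ,
       Adj-sym G ac , ad , Adj-sym G bd ,
       proj₂ (complement-Adj⁻ cd) , proj₂ (complement-Adj⁻ ab) ,
       proj₂ (complement-Adj⁻ bc) ∘ Adj-sym G)
    where
    ac = ¬complement-Adj⇒Adj a≢c ¬ac
    bd = ¬complement-Adj⇒Adj b≢d ¬bd
    ad = ¬complement-Adj⇒Adj a≢d ¬ad

Adj⇒complement²-Adj : ∀ {n} (G : Graph n) {u v} → Adj G u v → Adj (complement (complement G)) u v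
Adj⇒complement²-Adj G uv =
  complement-Adj⁺ (complement G) (Adj⇒≢ G uv) (λ uv′ → proj₂ (complement-Adj⁻ G uv′) uv)

removeZero : ∀ {n} → Graph (suc n) → Graph n
removeZero G = record
  { adj    = λ u v → adj G (suc u) (suc v)
  ; sym    = λ u v → Graph.sym G (suc u) (suc v)
  ; irrefl = irrefl G ∘ suc
  }

module _ {n : ℕ} (G : Graph (suc n)) where

  removeZero-cograph : Cograph G → Cograph (removeZero G)
  removeZero-cograph cg a b c d (a≢b , a≢c , a≢d , b≢c , b≢d , c≢d , edges) =
    cg (suc a) (suc b) (suc c) (suc d)
      (lift a≢b , lift a≢c , lift a≢d , lift b≢c , lift b≢d , lift c≢d , edges)
    where
    lift : ∀ {x y : Fin n} → x ≢ y → Fin.suc x ≢ suc y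
    lift x≢y = x≢y ∘ suc-injective

  removeZero-complement⇒complement-removeZero : ∀ {u v} →
    Adj (removeZero (complement G)) u v → Adj (complement (removeZero G)) u v
  removeZero-complement⇒complement-removeZero uv =
    complement-Adj⁺ (removeZero G) (proj₁ (complement-Adj⁻ G uv) ∘ cong suc)
      (proj₂ (complement-Adj⁻ G uv))

Split : ∀ {n} → (Fin n → Bool) → Set
Split P = (∃ λ u → P u ≡ true) × (∃ λ v → P v ≡ false)

Split-not : ∀ {n} {P : Fin n → Bool} → Split P → Split (not ∘ P)
Split-not ((u , pu) , (v , pv)) = (v , cong not pv) , (u , cong not pu)

module _ {n : ℕ} (G : Graph n) where

  Separates : (Fin n → Bool) → Set
  Separates P = ∀ u v → P u ≡ true → P v ≡ false → ¬ Adj G u v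

  Disconnected : Set
  Disconnected = ∃ λ P → Split P × Separates P

  Join : (Fin n → Bool) → Set
  Join P = ∀ u v → P u ≡ true → P v ≡ false → Adj G u v

  Separates-not : ∀ {P} → Separates P → Separates (not ∘ P)
  Separates-not sep u v pu pv uv =
    sep v u (not-injective pv) (not-injective pu) (Adj-sym G uv)

  Join-not : ∀ {P} → Join P → Join (not ∘ P)
  Join-not join u v pu pv = Adj-sym G (join v u (not-injective pv) (not-injective pu))

  Separates-Reach : ∀ {P} → Separates P → ∀ {u v} → P u ≡ true → Reach G u v → P v ≡ true
  Separates-Reach sep pu here = pu
  Separates-Reach {P} sep {u} pu (step {w = w} uw r) with P w in pw
  ... | true  = Separates-Reach sep pw r
  ... | false = contradiction uw (sep u w pu pw)

  Connected⇒¬Disconnected : Connected G → ¬ Disconnected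
  Connected⇒¬Disconnected conn (P , ((u , pu) , (v , pv)) , sep) =
    contradiction (trans (sym (Separates-Reach sep pu (conn u v))) pv) λ ()

Separates-mono : ∀ {n} (G H : Graph n) {P} → (∀ {u v} → Adj G u v → Adj H u v) →
  Separates H P → Separates G P
Separates-mono _ _ G⊆H sep u v pu pv = sep u v pu pv ∘ G⊆H

complement-Separates⇒Join : ∀ {n} (G : Graph n) {P} → Separates (complement G) P → Join G P
complement-Separates⇒Join G sep u v pu pv =
  ¬complement-Adj⇒Adj G u≢v (sep u v pu pv)
  where
  u≢v : u ≢ v
  u≢v refl = contradiction (trans (sym pu) pv) λ ()

Separates-extend : ∀ {n} (G : Graph (suc n)) {Q b} → Separates (removeZero G) Q →
  (∀ j → Q j ≡ not b → ¬ Adj G zero (suc j)) → Separates G (b Vector.∷ Q)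
Separates-extend G {b = true}  sepQ away zero    (suc v) _  qv = away v qv
Separates-extend G {b = false} sepQ away (suc u) zero    qu _  = away u qu ∘ Adj-sym G
Separates-extend G             sepQ away (suc u) (suc v) qu qv = sepQ u v qu qv

module ExtendSeparation {n : ℕ} (G : Graph (suc n)) (cg : Cograph G)
  (P : Fin n → Bool) (sep : Separates (removeZero G) P) where

  nonNeighbours : Fin n → Bool
  nonNeighbours j = P j ∧ not (adj G zero (suc j))

  nonNeighbours⁻ : ∀ {j} → nonNeighbours j ≡ true → P j ≡ true × ¬ Adj G zero (suc j)
  nonNeighbours⁻ {j} mj with P j | adj G zero (suc j)
  nonNeighbours⁻ _  | true | false = refl , λ ()

  nonNeighbours⁺ : ∀ {j} → P j ≡ true → ¬ Adj G zero (suc j) → nonNeighbours j ≡ true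
  nonNeighbours⁺ {j} pj ¬zj with P j | adj G zero (suc j)
  ... | true | true  = contradiction refl ¬zj
  ... | true | false = refl

  -- A neighbour t of zero outside P makes the non-neighbours of zero inside P
  -- a separated side: an edge from such a vertex u to a neighbour v of zero
  -- inside P would give the induced path t - zero - v - u.
  Separates-nonNeighbours : ∀ t → P t ≡ false → Adj G zero (suc t) →
    Separates (removeZero G) nonNeighbours
  Separates-nonNeighbours t pt zt u v mu mv uv
    with nonNeighbours⁻ mu | P v in pv | adj G zero (suc v) in zv
  ... | pu , _   | false | _     = sep u v pu pv uv
  ... | pu , ¬zu | true  | true  = cg (suc t) zero (suc v) (suc u)
      ((λ ()) , differ pt pv , differ pt pu , (λ ()) , (λ ()) , Adj⇒≢ G (Adj-sym G uv) ,
       Adj-sym G zt , zv , Adj-sym G uv ,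
       sep v t pv pt ∘ Adj-sym G , ¬zu , sep u t pu pt ∘ Adj-sym G)
    where
    differ : ∀ {x y} → P x ≡ false → P y ≡ true → Fin.suc x ≢ suc y
    differ px py refl = contradiction (trans (sym px) py) λ ()
  ... | _        | true  | false with mv
  ...   | ()

  disconnected : Split P → ∀ w → P w ≡ true → ¬ Adj G zero (suc w) → Disconnected G
  disconnected (_ , (q , pq)) w pw ¬zw
    with any? (λ t → (P t Bool.≟ false) ×-dec Adj? G zero (suc t))
  ... | no ¬outside =
    true Vector.∷ P , ((zero , refl) , (suc q , pq)) ,
    Separates-extend G sep (λ j pj zj → ¬outside (j , pj , zj))
  ... | yes (t , pt , zt) =
    false Vector.∷ nonNeighbours , ((suc w , nonNeighbours⁺ pw ¬zw) , (zero , refl)) ,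
    Separates-extend G (Separates-nonNeighbours t pt zt) (λ j mj → proj₂ (nonNeighbours⁻ mj))

extend-separation : ∀ {n} (G : Graph (suc n)) → Cograph G → ∀ {P} → Split P → Separates (removeZero G) P →
  Disconnected G ⊎ Disconnected (complement G)
extend-separation {n} G cg {P} split@(_ , (q , _)) sep with all? (λ j → Adj? G zero (suc j))
... | yes universal =
  inj₂ (true Vector.∷ (λ _ → false) , ((zero , refl) , (suc q , refl)) ,
        Separates-extend (complement G) (λ _ _ ())
          (λ j _ zj → proj₂ (complement-Adj⁻ G zj) (universal j)))
... | no ¬universal with ¬∀⟶∃¬ n _ (λ j → Adj? G zero (suc j)) ¬universal
... | w , ¬zw with P w in pw
... | true  = inj₁ (ExtendSeparation.disconnected G cg P sep split w pw ¬zw)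
... | false = inj₁ (ExtendSeparation.disconnected G cg (not ∘ P) (Separates-not (removeZero G) sep)
                     (Split-not split) w (cong not pw) ¬zw)

seinsche : ∀ n (G : Graph (suc (suc n))) → Cograph G → Disconnected G ⊎ Disconnected (complement G)
seinsche zero G cg = onEdge (Adj? G zero (suc zero))
  where
  onlyZero : Fin 2 → Bool
  onlyZero = true Vector.∷ λ _ → false
  split : Split onlyZero
  split = (zero , refl) , (suc zero , refl)
  onEdge : Dec (Adj G zero (suc zero)) → Disconnected G ⊎ Disconnected (complement G)
  onEdge (yes z1) = inj₂ (onlyZero , split , Separates-extend (complement G) (λ _ _ ())
                            λ { zero _ z1′ → proj₂ (complement-Adj⁻ G z1′) z1 })
  onEdge (no ¬z1) = inj₁ (onlyZero , split , Separates-extend G (λ _ _ ()) λ { zero _ → ¬z1 })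
seinsche (suc n) G cg with seinsche n (removeZero G) (removeZero-cograph G cg)
... | inj₁ (_ , split , sep) = extend-separation G cg split sep
... | inj₂ (_ , split , sep)
  with extend-separation (complement G) (complement-cograph G cg) split
         (Separates-mono (removeZero (complement G)) (complement (removeZero G))
           (removeZero-complement⇒complement-removeZero G) sep)
...   | inj₁ d = inj₂ d
...   | inj₂ (P , split′ , sep′) =
  inj₁ (P , split′ , Separates-mono G (complement (complement G)) (Adj⇒complement²-Adj G) sep′)

connected-cograph-join : ∀ n (G : Graph (suc (suc n))) → Connected G → Cograph G →
  ∃ λ P → Split P × Join G P
connected-cograph-join n G conn cg with seinsche n G cg
... | inj₁ d                 = contradiction d (Connected⇒¬Disconnected G conn)
... | inj₂ (P , split , sep) = P , split , complement-Separates⇒Join G sep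

anyFunction? : ∀ n {m} {Q : (Fin n → Fin m) → Set} →
  (∀ {c c′} → (∀ x → c x ≡ c′ x) → Q c → Q c′) → (∀ c → Dec (Q c)) → Dec (∃ Q)
anyFunction? zero Q-resp Q? with Q? (λ ())
... | yes q  = yes (_ , q)
... | no ¬q = no λ (c , qc) → ¬q (Q-resp (λ ()) qc)
anyFunction? (suc n) {Q = Q} Q-resp Q?
  with any? (λ i → anyFunction? n (λ eq → Q-resp (λ { zero → refl ; (suc x) → eq x }))
                                  (λ c → Q? (i Vector.∷ c)))
... | yes (i , c , q) = yes (i Vector.∷ c , q)
... | no ¬q = no λ (c , qc) → ¬q (c zero , c ∘ suc , Q-resp (λ { zero → refl ; (suc x) → refl }) qc)

module _ {P : ℕ → Set} (P? : Decidable P) where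

  Least : Set
  Least = ∃ λ k → P k × (∀ m → P m → k ≤ m)

  least : ∀ {v} → P v → Least
  least {v} = <-rec (λ v → P v → Least) search v
    where
    search : ∀ v → (∀ {m} → m < v → P m → Least) → P v → Least
    search v below pv with ℕ.anyUpTo? P? v
    ... | yes (m , m<v , pm) = below m<v pm
    ... | no none            = v , pv , λ m pm → ≮⇒≥ λ m<v → none (m , m<v , pm)

module _ {n : ℕ} (G : Graph n) where

  Colourable : ℕ → Set
  Colourable m = ∃ (Proper G m)

  colourable? : ∀ m → Dec (Colourable m)
  colourable? m = anyFunction? n resp proper?
    where
    resp : ∀ {c c′} → (∀ x → c x ≡ c′ x) → Proper G m c → Proper G m c′
    resp eq pc u v uv cu≡cv = pc u v uv (trans (eq u) (trans cu≡cv (sym (eq v))))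
    proper? : ∀ c → Dec (Proper G m c)
    proper? c = all? λ u → all? λ v → Adj? G u v →-dec ¬? (c u Fin.≟ c v)

  chromaticNumber : ∃ (IsChromaticNumber G)
  chromaticNumber with least colourable? (id , λ u v → Adj⇒≢ G)
  ... | k , colouring , minimal = k , colouring , λ m c pc → minimal m (c , pc)

  -- A colour missed by c could be punched out, giving a proper colouring with fewer colours.
  chromatic-AllUsed : ∀ {k} → IsChromaticNumber G k → ∀ c → Proper G k c → AllUsed G k c
  chromatic-AllUsed {suc k} (_ , minimal) c pc i with any? (λ v → c v Fin.≟ i)
  ... | yes used = used
  ... | no unused = contradiction (minimal k c′ pc′) 1+n≰n
    where
    missed : ∀ v → i ≢ c v
    missed v i≡cv = unused (v , sym i≡cv)
    c′ : Fin n → Fin k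
    c′ v = punchOut (missed v)
    pc′ : Proper G k c′
    pc′ u v uv = pc u v uv ∘ punchOut-injective (missed u) (missed v)

∣p∪q∣≤∣p∣+∣q∣ : ∀ {k} (p q : Subset k) → ∣ p ∪ q ∣ ≤ ∣ p ∣ + ∣ q ∣
∣p∪q∣≤∣p∣+∣q∣ []            []            = z≤n
∣p∪q∣≤∣p∣+∣q∣ (outside ∷ p) (outside ∷ q) = ∣p∪q∣≤∣p∣+∣q∣ p q
∣p∪q∣≤∣p∣+∣q∣ (outside ∷ p) (inside  ∷ q) =
  subst (suc ∣ p ∪ q ∣ ≤_) (sym (+-suc ∣ p ∣ ∣ q ∣)) (s≤s (∣p∪q∣≤∣p∣+∣q∣ p q))
∣p∪q∣≤∣p∣+∣q∣ (inside  ∷ p) (outside ∷ q) = s≤s (∣p∪q∣≤∣p∣+∣q∣ p q)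
∣p∪q∣≤∣p∣+∣q∣ (inside  ∷ p) (inside  ∷ q) =
  s≤s (≤-trans (∣p∪q∣≤∣p∣+∣q∣ p q) (+-mono-≤ (≤-refl {∣ p ∣}) (n≤1+n ∣ q ∣)))

x∈p∧y∈p∧x≢y⇒2≤∣p∣ : ∀ {k} {x y : Fin k} {p : Subset k} → x ∈ p → y ∈ p → x ≢ y → 2 ≤ ∣ p ∣
x∈p∧y∈p∧x≢y⇒2≤∣p∣ {x = x} {y} x∈p y∈p x≢y =
  subst (_< _) (∣⁅x⁆∣≡1 x) (p⊂q⇒∣p∣<∣q∣ ⁅x⁆⊂p)
  where
  ⁅x⁆⊂p : ⁅ x ⁆ ⊂ _
  ⁅x⁆⊂p = (λ z∈⁅x⁆ → subst (_∈ _) (sym (x∈⁅y⁆⇒x≡y x z∈⁅x⁆)) x∈p) ,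
          y , y∈p , λ y∈⁅x⁆ → x≢y (sym (x∈⁅y⁆⇒x≡y x y∈⁅x⁆))

∣⁅x⁆∪⁅y⁆∣≡2 : ∀ {k} {x y : Fin k} → x ≢ y → ∣ ⁅ x ⁆ ∪ ⁅ y ⁆ ∣ ≡ 2
∣⁅x⁆∪⁅y⁆∣≡2 {x = x} {y} x≢y = ≤-antisym
  (subst (∣ ⁅ x ⁆ ∪ ⁅ y ⁆ ∣ ≤_) (cong₂ _+_ (∣⁅x⁆∣≡1 x) (∣⁅x⁆∣≡1 y)) (∣p∪q∣≤∣p∣+∣q∣ ⁅ x ⁆ ⁅ y ⁆))
  (x∈p∧y∈p∧x≢y⇒2≤∣p∣ (x∈p∪q⁺ (inj₁ (x∈⁅x⁆ x))) (x∈p∪q⁺ (inj₂ (x∈⁅x⁆ y))) x≢y)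

module _ {n : ℕ} (G : Graph n) where

  -- A vertex of the dominated class must itself dominate a different class.
  DominatingFamily-2≤∣S∣ : ∀ {k c S} → Fin n → AllUsed G k c → DominatingFamily G k c S → 2 ≤ ∣ S ∣
  DominatingFamily-2≤∣S∣ v used dom with dom v
  ... | i , i∈S , _ with used i
  ...   | u , cu≡i with dom u
  ...     | j , j∈S , u↦j = x∈p∧y∈p∧x≢y⇒2≤∣p∣ i∈S j∈S λ i≡j → Adj⇒≢ G (u↦j u (trans cu≡i i≡j)) refl

  -- No colour of a proper colouring occurs on both sides of a join.
  Join-dominates : ∀ {P} → Join G P → ∀ {k c} → Proper G k c →
    ∀ {v b} → P v ≡ true → P b ≡ false → DominatesClass G k c v (c b)
  Join-dominates {P} join pc {v} {b} pv pb u cu≡cb with P u in pu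
  ... | true  = contradiction cu≡cb (pc u b (join u b pu pb))
  ... | false = join v u pv pu

  module _ {P : Fin n → Bool} (join : Join G P) {a b : Fin n} (pa : P a ≡ true) (pb : P b ≡ false)
    {k : ℕ} {c : Fin n → Fin k} (pc : Proper G k c) where

    Join-dominates-either : ∀ v → DominatesClass G k c v (c b) ⊎ DominatesClass G k c v (c a)
    Join-dominates-either v with P v in pv
    ... | true  = inj₁ (Join-dominates join pc pv pb)
    ... | false = inj₂ (Join-dominates (Join-not G join) pc (cong not pv) (cong not pa))

    Join-dominatingFamily : DominatingFamily G k c (⁅ c a ⁆ ∪ ⁅ c b ⁆)
    Join-dominatingFamily v with Join-dominates-either v
    ... | inj₁ v↦b = c b , x∈p∪q⁺ (inj₂ (x∈⁅x⁆ (c b))) , v↦b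
    ... | inj₂ v↦a = c a , x∈p∪q⁺ (inj₁ (x∈⁅x⁆ (c a))) , v↦a

    Join-isTDColoring : AllUsed G k c → IsTDColoring G k c
    Join-isTDColoring used =
      pc , used , λ v → let i , _ , v↦i = Join-dominatingFamily v in i , v↦i

    Join-minDominatingFamilySize : AllUsed G k c → MinDominatingFamilySize G k c 2
    Join-minDominatingFamilySize used =
      (⁅ c a ⁆ ∪ ⁅ c b ⁆ , Join-dominatingFamily , ∣⁅x⁆∪⁅y⁆∣≡2 (pc a b (join a b pa pb))) ,
      λ _ → DominatingFamily-2≤∣S∣ a used

  Join-isTDChromaticNumber : ∀ {P} → Join G P → ∀ {a b} → P a ≡ true → P b ≡ false →
    ∀ {k} → IsChromaticNumber G k → IsTDChromaticNumber G k
  Join-isTDChromaticNumber join pa pb χ@((c , pc) , minimal) =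
    (c , Join-isTDColoring join pa pb pc (chromatic-AllUsed G χ c pc)) ,
    λ m c′ td → minimal m c′ (proj₁ td)

theorem5 : (n : ℕ) (G : Graph n) → 2 ≤ n → Connected G → Cograph G →
    Σ ℕ (λ k → IsChromaticNumber G k × IsTDChromaticNumber G k ×
      ((c : Fin n → Fin k) → IsTDColoring G k c → MinDominatingFamilySize G k c 2))
theorem5 (suc (suc n)) G _ conn cg
  with connected-cograph-join n G conn cg | chromaticNumber G
... | _ , ((_ , pa) , (_ , pb)) , join | k , χ =
  k , χ , Join-isTDChromaticNumber G join pa pb χ ,
  λ c (pc , used , _) → Join-minDominatingFamilySize G join pa pb pc used
theorem5 (suc zero) G (s≤s ()) _ _
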